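{- Let $b,\phi,\hat\phi,c,\delta\in(0,1)$ with $c\le1/5$, $\phi<b$, $\delta\le c^2/\log n$ and $\hat\phi\le\phi/b$. Let $G=(V,E)$ be an $n$-vertex graph, fix a cluster $U\subseteq V$, and let $H=(V,E',w)$ be a weighted subgraph of $G$ with $H[U]\approx_\delta G[U]$. Then for all cuts $\emptyset\ne S\subsetneq U$ with $\Phi^\circ_U(S)<\hat\phi$, $$\Big(1-\frac c{\log n}\Big)\mathrm{vol}^\circ_U(S)\le\mathrm{vol}^\circ_{H,U}(S)\le\Big(1+\frac c{\log n}\Big)\mathrm{vol}^\circ_U(S).$$
   Context: $\log$ is base 2. $E(A,B)$ is the set of edges of $G$ between $A$ and $B$ and $\mathrm{vol}(S)$ the sum of degrees in $G$; $w(A,B)$ is the total weight of edges of $H$ between $A$ and $B$ and $\mathrm{vol}_H(S)$ the sum of weighted degrees in $H$. $H[U]\approx_\delta G[U]$ means: for all $S\subseteq U$, $\big|w(S,U\setminus S)-|E(S,U\setminus S)|\big|\le\delta|E(S,V\setminus S)|$, and for all $S\subseteq V$, $(1-\delta)|E(S,V\setminus S)|\le w(S,V\setminus S)\le(1+\delta)|E(S,V\setminus S)|$. For $S\subseteq U$: $\mathrm{vol}^\circ_U(S)=\mathrm{vol}(S)+\frac{b-\phi}\phi|E(S,V\setminus U)|$ and $\mathrm{vol}^\circ_{H,U}(S)=\mathrm{vol}_H(S)+\frac{b-\phi}\phi w(S,V\setminus U)$ (volumes in the graphs obtained from $G[U]$, resp. $H[U]$, by adding at each $u\in U$ a self-loop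 of weight $\frac b\phi$ times the (weighted) number of edges from $u$ to $V\setminus U$); for $\emptyset\ne S\subsetneq U$, $\Phi^\circ_U(S)=|E(S,U\setminus S)|/\min\{\mathrm{vol}^\circ_U(S),\mathrm{vol}^\circ_U(U\setminus S)\}$.
   Formalization: The parameters $b,\phi,\hat\phi,c,\delta$ and the edge weights of $H$ are rational. -}

module Defs where

open import Data.Bool using (Bool; true; false; if_then_else_)
open import Data.Nat as ℕ using (ℕ; zero; suc)
open import Data.Integer as ℤ using (ℤ; +_; -[1+_])
open import Data.Fin using (Fin; zero; suc)
open import Data.Fin.Subset using (Subset; _∩_; ∁; ⊤)
open import Data.Vec using (lookup)
open import Data.Rational as ℚ using (ℚ; 0ℚ; 1ℚ; _+_; _*_; _⊓_; ↥_; ↧_)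
open import Relation.Binary.PropositionalEquality using (_≡_; _≢_)

record Graph (n : ℕ) : Set where
  field
    adj   : Fin n → Fin n → Bool
    sym   : ∀ u v → adj u v ≡ adj v u
    irref : ∀ u → adj u u ≡ false
open Graph public

-- A weighted subgraph H = (V, E', w) of G: E' ⊆ E is the support of the
-- (symmetric, nonnegative) weight function w; w u v = 0 means {u,v} ∉ E'.
record WeightedSubgraph {n : ℕ} (G : Graph n) : Set where
  field
    w       : Fin n → Fin n → ℚ
    w-sym   : ∀ u v → w u v ≡ w v u
    w-nonneg : ∀ u v → 0ℚ ℚ.≤ w u v
    w-sub   : ∀ u v → w u v ≢ 0ℚ → adj G u v ≡ true
open WeightedSubgraph public

sumFin : ∀ {n} → (Fin n → ℚ) → ℚ
sumFin {zero}  f = 0ℚ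
sumFin {suc n} f = f zero + sumFin (λ i → f (suc i))

[_] : Bool → ℚ
[ b ] = if b then 1ℚ else 0ℚ

χ : ∀ {n} → Subset n → Fin n → ℚ
χ S u = [ lookup S u ]

-- |E(A,B)| : number of edges of G with one end in A and the other in B
-- (counted as ordered pairs (u,v), u ∈ A, v ∈ B; used for disjoint A, B).
E : ∀ {n} → Graph n → Subset n → Subset n → ℚ
E G A B = sumFin λ u → sumFin λ v → χ A u * χ B v * [ adj G u v ]

wt : ∀ {n} {G : Graph n} → WeightedSubgraph G → Subset n → Subset n → ℚ
wt H A B = sumFin λ u → sumFin λ v → χ A u * χ B v * w H u v

vol : ∀ {n} → Graph n → Subset n → ℚ
vol G S = sumFin λ u → χ S u * (sumFin λ v → [ adj G u v ])

volH : ∀ {n} {G : Graph n} → WeightedSubgraph G → Subset n → ℚ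
volH H S = sumFin λ u → χ S u * (sumFin λ v → w H u v)

-- vol°_U(S) = vol(S) + κ |E(S, V∖U)|   where κ = (b - φ)/φ
volC : ∀ {n} → ℚ → Graph n → Subset n → Subset n → ℚ
volC κ G U S = vol G S + κ * E G S (∁ U)

volCH : ∀ {n} {G : Graph n} → ℚ → WeightedSubgraph G → Subset n → Subset n → ℚ
volCH κ H U S = volH H S + κ * wt H S (∁ U)

-- "Φ°_U(S) < φ̂", i.e. |E(S,U∖S)| / min{vol°_U(S), vol°_U(U∖S)} < φ̂,
-- written with the denominator multiplied out.
ConductanceBelow : ∀ {n} → ℚ → Graph n → Subset n → Subset n → ℚ → Set
ConductanceBelow κ G U S φ̂ =
  E G S (U ∩ ∁ S) ℚ.< φ̂ * (volC κ G U S ⊓ volC κ G U (U ∩ ∁ S))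

Approx : ∀ {n} {G : Graph n} → ℚ → WeightedSubgraph G → Subset n → Set
Approx {n} {G} δ H U =
  (∀ (S : Subset n) → S Data.Fin.Subset.⊆ U →
     ℚ.∣ wt H S (U ∩ ∁ S) ℚ.- E G S (U ∩ ∁ S) ∣ ℚ.≤ δ * E G S (∁ S))
  Data.Product.× (∀ (S : Subset n) →
     ((1ℚ ℚ.- δ) * E G S (∁ S) ℚ.≤ wt H S (∁ S))
     Data.Product.× (wt H S (∁ S) ℚ.≤ (1ℚ + δ) * E G S (∁ S)))
  where import Data.Product

pos neg : ℤ → ℕ
pos (+ k)      = k
pos -[1+ k ]   = 0
neg (+ k)      = 0
neg -[1+ k ]   = suc k

-- x · log₂ n ≤ y   (for n ≥ 1).  Writing x = p/q, y = r/s, this is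
-- (p s) log₂ n ≤ r q, i.e. n^(A) ≤ 2^(B) with A = p s, B = r q ∈ ℤ,
-- i.e. n^(A⁺) · 2^(B⁻) ≤ 2^(B⁺) · n^(A⁻).
MulLog≤ : ℕ → ℚ → ℚ → Set
MulLog≤ n x y =
  n ℕ.^ pos A ℕ.* 2 ℕ.^ neg B ℕ.≤ 2 ℕ.^ pos B ℕ.* n ℕ.^ neg A
  where
  A = (↥ x) ℤ.* (↧ y)
  B = (↥ y) ℤ.* (↧ x)

{-# OPTIONS --safe #-}
module Submission where

-- Let a, e be the numbers of edges from S to U ∖ S and to V ∖ U, a_H, e_H their
-- H-weights, and κ = (b - φ)/φ, so that vol° = vol(S) + κ e and vol°_H = vol_H(S) + κ e_H.
-- Single-vertex cuts give every weighted degree within a factor 1 ± δ of the degree, hence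
-- |vol_H(S) - vol(S)| ≤ δ vol(S). The cut S of U and the cut S of V give
-- |a_H - a| ≤ δ (a + e) and |a_H + e_H - a - e| ≤ δ (a + e), hence |e_H - e| ≤ 2δ (a + e).
-- Low conductance gives a ≤ φ̂ vol° ≤ (φ/b) vol°, and κ φ/b = 1 - φ/b ≤ 1, so κ a ≤ vol°.
-- Altogether |vol°_H - vol°| ≤ δ vol(S) + 2κδ (a + e) ≤ 4δ vol°, and since
-- δ log n ≤ c² and 4c ≤ 1, this is at most (c / log n) vol°.

module PowerComparison where
  open import Data.Nat
  open import Data.Nat.Properties
  open import Relation.Binary.PropositionalEquality

  ^-cancelˡ-≤ : ∀ k .{{_ : NonZero k}} {m n} → m ^ k ≤ n ^ k → m ≤ n
  ^-cancelˡ-≤ k mᵏ≤nᵏ = ≮⇒≥ (λ n<m → <⇒≱ (^-monoˡ-< k n<m) mᵏ≤nᵏ)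

  -- n ^ a ≤ 2 ^ b says log₂ n ≤ b / a, and b′ / a′ ≥ b / a.
  n^≤2^-rescale : ∀ {n a b a′ b′} .{{_ : NonZero a}} →
    a′ * b ≤ a * b′ → n ^ a ≤ 2 ^ b → n ^ a′ ≤ 2 ^ b′
  n^≤2^-rescale {n} {a} {b} {a′} {b′} a′b≤ab′ nᵃ≤2ᵇ = ^-cancelˡ-≤ a (begin
    (n ^ a′) ^ a  ≡⟨ ^-*-assoc n a′ a ⟩
    n ^ (a′ * a)  ≡⟨ cong (n ^_) (*-comm a′ a) ⟩
    n ^ (a * a′)  ≡⟨ ^-*-assoc n a a′ ⟨
    (n ^ a) ^ a′  ≤⟨ ^-monoˡ-≤ a′ nᵃ≤2ᵇ ⟩
    (2 ^ b) ^ a′  ≡⟨ ^-*-assoc 2 b a′ ⟩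
    2 ^ (b * a′)  ≡⟨ cong (2 ^_) (*-comm b a′) ⟩
    2 ^ (a′ * b)  ≤⟨ ^-monoʳ-≤ 2 a′b≤ab′ ⟩
    2 ^ (a * b′)  ≡⟨ cong (2 ^_) (*-comm a b′) ⟩
    2 ^ (b′ * a)  ≡⟨ ^-*-assoc 2 b′ a ⟨
    (2 ^ b′) ^ a  ∎)
    where open ≤-Reasoning

module RationalBounds where
  open import Data.Integer as ℤ using (+_; -[1+_])
  open import Data.Product using (_×_; _,_)
  open import Data.Sum using (inj₁; inj₂)
  open import Data.Rational as ℚ using (ℚ; mkℚ; 0ℚ; 1ℚ; _+_; _*_; _-_; -_; ∣_∣; _≤_; _<_; *≤*)
  open import Data.Rational.Properties
  open import Level using (0ℓ)
  open import Relation.Binary.PropositionalEquality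
  open import Relation.Nullary.Decidable using (dec⇒maybe)
  open import Tactic.RingSolver using (solve-∀)
  open import Tactic.RingSolver.Core.AlmostCommutativeRing
    using (AlmostCommutativeRing; fromCommutativeRing)

  ring : AlmostCommutativeRing 0ℓ 0ℓ
  ring = fromCommutativeRing +-*-commutativeRing (λ x → dec⇒maybe (0ℚ ≟ x))

  p≤q⇒0≤q-p : ∀ {p q} → p ≤ q → 0ℚ ≤ q - p
  p≤q⇒0≤q-p {p} {q} p≤q = subst (_≤ q - p) (+-inverseʳ p) (+-monoˡ-≤ (- p) p≤q)

  0≤q-p⇒p≤q : ∀ {p q} → 0ℚ ≤ q - p → p ≤ q
  0≤q-p⇒p≤q {p} {q} 0≤q-p = subst₂ _≤_ (+-identityˡ p) (q-p+p≡q q p) (+-monoˡ-≤ p 0≤q-p)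
    where
    q-p+p≡q : ∀ q p → q - p + p ≡ q
    q-p+p≡q = solve-∀ ring

  +-nonNeg : ∀ {p q} → 0ℚ ≤ p → 0ℚ ≤ q → 0ℚ ≤ p + q
  +-nonNeg = +-mono-≤

  *-nonNeg : ∀ {p q} → 0ℚ ≤ p → 0ℚ ≤ q → 0ℚ ≤ p * q
  *-nonNeg {p} {q} 0≤p 0≤q = nonNegative⁻¹ (p * q)
    {{nonNeg*nonNeg⇒nonNeg p {{ℚ.nonNegative 0≤p}} q {{ℚ.nonNegative 0≤q}}}}

  *-pos : ∀ {p q} → 0ℚ < p → 0ℚ < q → 0ℚ < p * q
  *-pos {p} {q} 0<p 0<q = positive⁻¹ (p * q)
    {{pos*pos⇒pos p {{ℚ.positive 0<p}} q {{ℚ.positive 0<q}}}}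

  p≤∣p∣ : ∀ p → p ≤ ∣ p ∣
  p≤∣p∣ (mkℚ (+ _) _ _)    = ≤-refl
  p≤∣p∣ (mkℚ -[1+ _ ] _ _) = *≤* ℤ.-≤+

  -[p-q]≡q-p : ∀ p q → - (p - q) ≡ q - p
  -[p-q]≡q-p = solve-∀ ring

  ∣p-q∣≡∣q-p∣ : ∀ p q → ∣ p - q ∣ ≡ ∣ q - p ∣
  ∣p-q∣≡∣q-p∣ p q = trans (sym (∣-p∣≡∣p∣ (p - q))) (cong ∣_∣ (-[p-q]≡q-p p q))

  Within : ℚ → ℚ → ℚ → Set
  Within ε x y = ∣ x - y ∣ ≤ ε

  within⇒≤ : ∀ {ε x y} → Within ε x y → x - y ≤ ε × y - x ≤ ε
  within⇒≤ {ε} {x} {y} x≈y = ≤-trans (p≤∣p∣ (x - y)) x≈y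
                           , ≤-trans (p≤∣p∣ (y - x)) (subst (_≤ ε) (∣p-q∣≡∣q-p∣ x y) x≈y)

  ≤⇒within : ∀ {ε x y} → x - y ≤ ε → y - x ≤ ε → Within ε x y
  ≤⇒within {ε} {x} {y} x-y≤ε y-x≤ε with ∣p∣≡p∨∣p∣≡-p (x - y)
  ... | inj₁ ∣x-y∣≡x-y    = subst (_≤ ε) (sym ∣x-y∣≡x-y) x-y≤ε
  ... | inj₂ ∣x-y∣≡-[x-y] = subst (_≤ ε) (sym (trans ∣x-y∣≡-[x-y] (-[p-q]≡q-p x y))) y-x≤ε

  within-+ : ∀ {ε ε′ x x′ y y′} → Within ε x y → Within ε′ x′ y′ →
    Within (ε + ε′) (x + x′) (y + y′)
  within-+ {ε} {ε′} {x} {x′} {y} {y′} x≈y x′≈y′ = begin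
    ∣ (x + x′) - (y + y′) ∣  ≡⟨ cong ∣_∣ (interchange x x′ y y′) ⟩
    ∣ (x - y) + (x′ - y′) ∣  ≤⟨ ∣p+q∣≤∣p∣+∣q∣ (x - y) (x′ - y′) ⟩
    ∣ x - y ∣ + ∣ x′ - y′ ∣  ≤⟨ +-mono-≤ x≈y x′≈y′ ⟩
    ε + ε′                   ∎
    where
    open ≤-Reasoning
    interchange : ∀ x x′ y y′ → (x + x′) - (y + y′) ≡ (x - y) + (x′ - y′)
    interchange = solve-∀ ring

  within-- : ∀ {ε ε′ x x′ y y′} → Within ε x y → Within ε′ x′ y′ →
    Within (ε + ε′) (x - x′) (y - y′)
  within-- {ε} {ε′} {x} {x′} {y} {y′} x≈y x′≈y′ = begin
    ∣ (x - x′) - (y - y′) ∣  ≡⟨ cong ∣_∣ (interchange x x′ y y′) ⟩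
    ∣ (x - y) - (x′ - y′) ∣  ≤⟨ ∣p-q∣≤∣p∣+∣q∣ (x - y) (x′ - y′) ⟩
    ∣ x - y ∣ + ∣ x′ - y′ ∣  ≤⟨ +-mono-≤ x≈y x′≈y′ ⟩
    ε + ε′                   ∎
    where
    open ≤-Reasoning
    interchange : ∀ x x′ y y′ → (x - x′) - (y - y′) ≡ (x - y) - (x′ - y′)
    interchange = solve-∀ ring

  within-*ˡ : ∀ {ε k x y} → 0ℚ ≤ k → Within ε x y → Within (k * ε) (k * x) (k * y)
  within-*ˡ {ε} {k} {x} {y} 0≤k x≈y = begin
    ∣ k * x - k * y ∣  ≡⟨ cong ∣_∣ (*-distribˡ-- k x y) ⟩
    ∣ k * (x - y) ∣    ≡⟨ ∣p*q∣≡∣p∣*∣q∣ k (x - y) ⟩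
    ∣ k ∣ * ∣ x - y ∣  ≡⟨ cong (_* ∣ x - y ∣) (0≤p⇒∣p∣≡p 0≤k) ⟩
    k * ∣ x - y ∣      ≤⟨ *-monoˡ-≤-nonNeg k {{ℚ.nonNegative 0≤k}} x≈y ⟩
    k * ε              ∎
    where
    open ≤-Reasoning
    *-distribˡ-- : ∀ k x y → k * x - k * y ≡ k * (x - y)
    *-distribˡ-- = solve-∀ ring

  within-relative : ∀ {δ x y} → (1ℚ - δ) * x ≤ y → y ≤ (1ℚ + δ) * x → Within (δ * x) y x
  within-relative {δ} {x} {y} lower upper = ≤⇒within {δ * x} {y} {x}
    (0≤q-p⇒p≤q (subst (0ℚ ≤_) (upper-slack δ x y) (p≤q⇒0≤q-p upper)))
    (0≤q-p⇒p≤q (subst (0ℚ ≤_) (lower-slack δ x y) (p≤q⇒0≤q-p lower)))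
    where
    upper-slack : ∀ δ x y → (1ℚ + δ) * x - y ≡ δ * x - (y - x)
    upper-slack = solve-∀ ring
    lower-slack : ∀ δ x y → y - (1ℚ - δ) * x ≡ δ * x - (x - y)
    lower-slack = solve-∀ ring

module LogComparison where
  open import Defs using (MulLog≤; pos; neg)
  open PowerComparison
  open RationalBounds
  open import Data.Nat as ℕ using (ℕ; suc; NonZero)
  import Data.Nat.Properties as ℕP
  import Data.Nat.Tactic.RingSolver as ℕ-Solver
  open import Data.Nat.Coprimality using (Coprime)
  open import Data.Integer as ℤ using (+0; +[1+_]; -[1+_])
  import Data.Integer.Properties as ℤP
  open import Data.Rational as ℚ using (ℚ; mkℚ; 0ℚ; 1ℚ; _*_; _≤_; _<_; *<*; *≤*; ↥_; ↧_)
  import Data.Rational.Properties as ℚP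
  import Data.Rational.Unnormalised.Properties as ℚᵘP
  open import Relation.Binary.PropositionalEquality
  open import Relation.Nullary using (yes; no)
  open import Tactic.RingSolver using (solve-∀)

  data PositiveView : ℚ → Set where
    mkℚ⁺ : ∀ p q .(c : Coprime (suc p) (suc q)) → PositiveView (mkℚ +[1+ p ] q c)

  positiveView : ∀ {x} → 0ℚ < x → PositiveView x
  positiveView {mkℚ +[1+ p ] q c} _ = mkℚ⁺ p q c
  positiveView {mkℚ +0 _ _}       (*<* (ℤ.+<+ ()))
  positiveView {mkℚ -[1+ _ ] _ _} (*<* ())

  n^≤2^⇒mulLog≤⁺ : ∀ {n p q r s} .{c : Coprime (suc p) (suc q)} .{d : Coprime (suc r) (suc s)} →
    n ℕ.^ (suc p ℕ.* suc s) ℕ.≤ 2 ℕ.^ (suc r ℕ.* suc q) →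
    MulLog≤ n (mkℚ +[1+ p ] q c) (mkℚ +[1+ r ] s d)
  n^≤2^⇒mulLog≤⁺ = subst₂ ℕ._≤_ (sym (ℕP.*-identityʳ _)) (sym (ℕP.*-identityʳ _))

  mulLog≤⁺⇒n^≤2^ : ∀ {n p q r s} .{c : Coprime (suc p) (suc q)} .{d : Coprime (suc r) (suc s)} →
    MulLog≤ n (mkℚ +[1+ p ] q c) (mkℚ +[1+ r ] s d) →
    n ℕ.^ (suc p ℕ.* suc s) ℕ.≤ 2 ℕ.^ (suc r ℕ.* suc q)
  mulLog≤⁺⇒n^≤2^ = subst₂ ℕ._≤_ (ℕP.*-identityʳ _) (ℕP.*-identityʳ _)

  mulLog≤-rescale : ∀ n {x y x′ y′} → 0ℚ < x → 0ℚ < y → 0ℚ < x′ → 0ℚ < y′ →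
    x′ * y ≤ x * y′ → MulLog≤ n x y → MulLog≤ n x′ y′
  mulLog≤-rescale n {x} {y} {x′} {y′} 0<x 0<y 0<x′ 0<y′ x′y≤xy′ xlog≤y
    with positiveView 0<x | positiveView 0<y | positiveView 0<x′ | positiveView 0<y′
  ... | mkℚ⁺ p q cx | mkℚ⁺ r s cy | mkℚ⁺ p′ q′ cx′ | mkℚ⁺ r′ s′ cy′ =
    n^≤2^⇒mulLog≤⁺ {n} {p′} {q′} {r′} {s′} {cx′} {cy′}
      (n^≤2^-rescale {n} {P ℕ.* S} {R ℕ.* Q} {P′ ℕ.* S′} {R′ ℕ.* Q′} {{ℕP.m*n≢0 P S}} exponents
        (mulLog≤⁺⇒n^≤2^ {n} {p} {q} {r} {s} {cx} {cy} xlog≤y))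
    where
    P Q R S P′ Q′ R′ S′ : ℕ
    P = suc p; Q = suc q; R = suc r; S = suc s
    P′ = suc p′; Q′ = suc q′; R′ = suc r′; S′ = suc s′
    cross-multiplied : P′ ℕ.* R ℕ.* (Q ℕ.* S′) ℕ.≤ P ℕ.* R′ ℕ.* (Q′ ℕ.* S)
    cross-multiplied = ℤP.drop‿+≤+ (ℚᵘP.drop-*≤* (ℚᵘP.≤-respʳ-≃ (ℚP.toℚᵘ-homo-* x y′)
      (ℚᵘP.≤-respˡ-≃ (ℚP.toℚᵘ-homo-* x′ y) (ℚP.toℚᵘ-mono-≤ x′y≤xy′))))
    regroup : ∀ a b c d → a ℕ.* b ℕ.* (c ℕ.* d) ≡ a ℕ.* d ℕ.* (b ℕ.* c)
    regroup = ℕ-Solver.solve-∀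
    exponents : P′ ℕ.* S′ ℕ.* (R ℕ.* Q) ℕ.≤ P ℕ.* S ℕ.* (R′ ℕ.* Q′)
    exponents = subst₂ ℕ._≤_ (regroup P′ R Q S′) (regroup P R′ Q′ S) cross-multiplied

  1≤2^*n^ : ∀ n .{{_ : NonZero n}} x y →
    1 ℕ.≤ 2 ℕ.^ pos (↥ y ℤ.* ↧ x) ℕ.* n ℕ.^ neg (↥ x ℤ.* ↧ y)
  1≤2^*n^ n x y = ℕP.*-mono-≤ (ℕP.m^n>0 2 (pos (↥ y ℤ.* ↧ x))) (ℕP.m^n>0 n (neg (↥ x ℤ.* ↧ y)))

  -- In the remaining cases the left-hand side of MulLog≤ computes to n ^ 0 * 2 ^ 0.
  mulLog≤-nonPos : ∀ n .{{_ : NonZero n}} {x y} → x ≤ 0ℚ → 0ℚ ≤ y → MulLog≤ n x y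
  mulLog≤-nonPos n {mkℚ +[1+ _ ] _ _} (*≤* (ℤ.+≤+ ())) _
  mulLog≤-nonPos n {y = mkℚ -[1+ _ ] _ _} _ (*≤* ())
  mulLog≤-nonPos n {x@(mkℚ +0 _ _)}       {y@(mkℚ +0 _ _)}       _ _ = 1≤2^*n^ n x y
  mulLog≤-nonPos n {x@(mkℚ +0 _ _)}       {y@(mkℚ +[1+ _ ] _ _)} _ _ = 1≤2^*n^ n x y
  mulLog≤-nonPos n {x@(mkℚ -[1+ _ ] _ _)} {y@(mkℚ +0 _ _)}       _ _ = 1≤2^*n^ n x y
  mulLog≤-nonPos n {x@(mkℚ -[1+ _ ] _ _)} {y@(mkℚ +[1+ _ ] _ _)} _ _ = 1≤2^*n^ n x y

  mulLog≤-transfer : ∀ n .{{_ : NonZero n}} {t δ c C d} → 0ℚ ≤ t → 0ℚ < δ → 0ℚ < c →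
    t * c ≤ 1ℚ → 0ℚ ≤ C → MulLog≤ n δ (c * c) → d ≤ t * δ * C → MulLog≤ n d (c * C)
  mulLog≤-transfer n {t} {δ} {c} {C} {d} 0≤t 0<δ 0<c tc≤1 0≤C δlog≤c² d≤tδC with d ℚP.≤? 0ℚ
  ... | yes d≤0 = mulLog≤-nonPos n d≤0 (*-nonNeg (ℚP.<⇒≤ 0<c) 0≤C)
  ... | no  d≰0 = mulLog≤-rescale n 0<δ (*-pos 0<c 0<c) 0<d (*-pos 0<c 0<C) dc²≤δcC δlog≤c²
    where
    0<d : 0ℚ < d
    0<d = ℚP.≰⇒> d≰0
    0<C : 0ℚ < C
    0<C = ℚP.*-cancelˡ-<-nonNeg (t * δ) {{ℚ.nonNegative (*-nonNeg 0≤t (ℚP.<⇒≤ 0<δ))}}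
      (subst (_< t * δ * C) (sym (ℚP.*-zeroʳ (t * δ))) (ℚP.<-≤-trans 0<d d≤tδC))
    0≤δcC : 0ℚ ≤ δ * (c * C)
    0≤δcC = *-nonNeg (ℚP.<⇒≤ 0<δ) (*-nonNeg (ℚP.<⇒≤ 0<c) 0≤C)
    regroup : ∀ t δ c C → t * δ * C * (c * c) ≡ δ * (c * C) * (t * c)
    regroup = solve-∀ ring
    dc²≤δcC : d * (c * c) ≤ δ * (c * C)
    dc²≤δcC = begin
      d * (c * c)            ≤⟨ ℚP.*-monoʳ-≤-nonNeg (c * c)
                                  {{ℚ.nonNegative (ℚP.<⇒≤ (*-pos 0<c 0<c))}} d≤tδC ⟩
      t * δ * C * (c * c)    ≡⟨ regroup t δ c C ⟩
      δ * (c * C) * (t * c)  ≤⟨ ℚP.*-monoˡ-≤-nonNeg (δ * (c * C)) {{ℚ.nonNegative 0≤δcC}} tc≤1 ⟩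
      δ * (c * C) * 1ℚ       ≡⟨ ℚP.*-identityʳ (δ * (c * C)) ⟩
      δ * (c * C)            ∎
      where open ℚP.≤-Reasoning

module FiniteSums where
  open RationalBounds using (ring; +-nonNeg)
  open import Defs using (sumFin; χ; [_])
  open import Data.Bool using (true; false; not)
  open import Data.Nat using (zero; suc)
  open import Data.Fin using (Fin; zero; suc)
  open import Data.Fin.Subset using (Subset; ⁅_⁆; ∁; ⊥)
  open import Data.Vec using (lookup)
  open import Data.Vec.Properties using (lookup-map; lookup-replicate)
  open import Data.Rational as ℚ using (ℚ; 0ℚ; 1ℚ; _+_; _*_; _≤_)
  open import Data.Rational.Properties
  open import Function using (_∘_)
  open import Relation.Binary.PropositionalEquality hiding ([_])
  open import Tactic.RingSolver using (solve-∀)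

  sumFin-cong : ∀ {n} {f g : Fin n → ℚ} → (∀ i → f i ≡ g i) → sumFin f ≡ sumFin g
  sumFin-cong {zero}  f≗g = refl
  sumFin-cong {suc n} f≗g = cong₂ _+_ (f≗g zero) (sumFin-cong (f≗g ∘ suc))

  sumFin-+ : ∀ {n} (f g : Fin n → ℚ) → sumFin (λ i → f i + g i) ≡ sumFin f + sumFin g
  sumFin-+ {zero}  f g = refl
  sumFin-+ {suc n} f g =
    trans (cong (f zero + g zero +_) (sumFin-+ (f ∘ suc) (g ∘ suc)))
          (middle-swap (f zero) (g zero) (sumFin (f ∘ suc)) (sumFin (g ∘ suc)))
    where
    middle-swap : ∀ a b c d → a + b + (c + d) ≡ a + c + (b + d)
    middle-swap = solve-∀ ring

  sumFin-*ˡ : ∀ {n} c (f : Fin n → ℚ) → sumFin (λ i → c * f i) ≡ c * sumFin f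
  sumFin-*ˡ {zero}  c f = sym (*-zeroʳ c)
  sumFin-*ˡ {suc n} c f =
    trans (cong (c * f zero +_) (sumFin-*ˡ c (f ∘ suc))) (sym (*-distribˡ-+ c (f zero) _))

  sumFin-mono : ∀ {n} {f g : Fin n → ℚ} → (∀ i → f i ≤ g i) → sumFin f ≤ sumFin g
  sumFin-mono {zero}  f≤g = ≤-refl
  sumFin-mono {suc n} f≤g = +-mono-≤ (f≤g zero) (sumFin-mono (f≤g ∘ suc))

  sumFin-nonNeg : ∀ {n} {f : Fin n → ℚ} → (∀ i → 0ℚ ≤ f i) → 0ℚ ≤ sumFin f
  sumFin-nonNeg {zero}  0≤f = ≤-refl
  sumFin-nonNeg {suc n} 0≤f = +-nonNeg (0≤f zero) (sumFin-nonNeg (0≤f ∘ suc))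

  sumFin-weighted-mono : ∀ {n} {x f g : Fin n → ℚ} → (∀ i → 0ℚ ≤ x i) → (∀ i → f i ≤ g i) →
    sumFin (λ i → x i * f i) ≤ sumFin (λ i → x i * g i)
  sumFin-weighted-mono {x = x} 0≤x f≤g =
    sumFin-mono (λ i → *-monoˡ-≤-nonNeg (x i) {{ℚ.nonNegative (0≤x i)}} (f≤g i))

  sumFin-weighted-*ˡ : ∀ {n} (x : Fin n → ℚ) c (g : Fin n → ℚ) →
    sumFin (λ i → x i * (c * g i)) ≡ c * sumFin (λ i → x i * g i)
  sumFin-weighted-*ˡ x c g =
    trans (sumFin-cong (λ i → swap (x i) c (g i))) (sumFin-*ˡ c (λ i → x i * g i))
    where
    swap : ∀ a b c → a * (b * c) ≡ b * (a * c)
    swap = solve-∀ ring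

  [b]-nonNeg : ∀ b → 0ℚ ≤ [ b ]
  [b]-nonNeg true  = <⇒≤ (positive⁻¹ 1ℚ)
  [b]-nonNeg false = ≤-refl

  χ-nonNeg : ∀ {n} (A : Subset n) i → 0ℚ ≤ χ A i
  χ-nonNeg A i = [b]-nonNeg (lookup A i)

  χ-∁ : ∀ {n} (A : Subset n) i → χ (∁ A) i + χ A i ≡ 1ℚ
  χ-∁ A i rewrite lookup-map i not A with lookup A i
  ... | true  = refl
  ... | false = refl

  sumFin-⁅⁆ : ∀ {n} (u : Fin n) (f : Fin n → ℚ) → sumFin (λ i → χ ⁅ u ⁆ i * f i) ≡ f u
  sumFin-⁅⁆ zero f = begin
    1ℚ * f zero + sumFin (λ i → [ lookup ⊥ i ] * f (suc i))  ≡⟨ cong (1ℚ * f zero +_) rest≡0 ⟩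
    1ℚ * f zero + 0ℚ                                          ≡⟨ +-identityʳ (1ℚ * f zero) ⟩
    1ℚ * f zero                                               ≡⟨ *-identityˡ (f zero) ⟩
    f zero                                                    ∎
    where
    open ≡-Reasoning
    rest≡0 : sumFin (λ i → [ lookup ⊥ i ] * f (suc i)) ≡ 0ℚ
    rest≡0 = begin
      sumFin (λ i → [ lookup ⊥ i ] * f (suc i))
        ≡⟨ sumFin-cong (λ i → cong (λ b → [ b ] * f (suc i)) (lookup-replicate i false)) ⟩
      sumFin (λ i → 0ℚ * f (suc i))  ≡⟨ sumFin-*ˡ 0ℚ (f ∘ suc) ⟩
      0ℚ * sumFin (f ∘ suc)          ≡⟨ *-zeroˡ (sumFin (f ∘ suc)) ⟩
      0ℚ                             ∎
  sumFin-⁅⁆ (suc u) f =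
    trans (cong₂ _+_ (*-zeroˡ (f zero)) (sumFin-⁅⁆ u (f ∘ suc))) (+-identityˡ (f (suc u)))

  sumFin-∁⁅⁆ : ∀ {n} (u : Fin n) (f : Fin n → ℚ) → f u ≡ 0ℚ →
    sumFin (λ i → χ (∁ ⁅ u ⁆) i * f i) ≡ sumFin f
  sumFin-∁⁅⁆ {n} u f fu≡0 = sym (begin
    sumFin f                                  ≡⟨ sumFin-cong split ⟩
    sumFin (λ i → outside i + inside i)       ≡⟨ sumFin-+ outside inside ⟩
    sumFin outside + sumFin inside            ≡⟨ cong (sumFin outside +_) sum-inside≡0 ⟩
    sumFin outside + 0ℚ                       ≡⟨ +-identityʳ (sumFin outside) ⟩
    sumFin outside                            ∎)
    where
    open ≡-Reasoning
    outside inside : Fin n → ℚ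
    outside i = χ (∁ ⁅ u ⁆) i * f i
    inside  i = χ ⁅ u ⁆ i * f i
    sum-inside≡0 : sumFin inside ≡ 0ℚ
    sum-inside≡0 = trans (sumFin-⁅⁆ u f) fu≡0
    split : ∀ i → f i ≡ outside i + inside i
    split i = begin
      f i                                ≡⟨ *-identityˡ (f i) ⟨
      1ℚ * f i                           ≡⟨ cong (_* f i) (χ-∁ ⁅ u ⁆ i) ⟨
      (χ (∁ ⁅ u ⁆) i + χ ⁅ u ⁆ i) * f i  ≡⟨ *-distribʳ-+ (f i) (χ (∁ ⁅ u ⁆) i) (χ ⁅ u ⁆ i) ⟩
      outside i + inside i               ∎

module Cuts where
  open import Defs hiding (sym)
  open FiniteSums
  open RationalBounds using (ring; *-nonNeg)
  open import Data.Bool using (true; false; not; _∧_)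
  open import Data.Product using (_×_; _,_; proj₁; proj₂)
  open import Data.Fin using (Fin)
  open import Data.Fin.Subset using (Subset; ⁅_⁆; ∁; _∩_; _⊆_)
  open import Function using (_∘_)
  open import Data.Vec using (lookup)
  open import Data.Vec.Properties using (lookup-map; lookup-zipWith; lookup⇒[]=; []=⇒lookup)
  open import Data.Rational as ℚ using (ℚ; 0ℚ; 1ℚ; _+_; _*_; _-_; _≤_)
  open import Data.Rational.Properties
  open import Relation.Binary.PropositionalEquality hiding ([_])
  open import Relation.Nullary using (yes; no)
  open import Tactic.RingSolver using (solve-∀)

  cutSum : ∀ {n} → (Fin n → Fin n → ℚ) → Subset n → Subset n → ℚ
  cutSum f A B = sumFin λ u → sumFin λ v → χ A u * χ B v * f u v

  cutSum-split : ∀ {n} (f : Fin n → Fin n → ℚ) A B B₁ B₂ → (∀ v → χ B v ≡ χ B₁ v + χ B₂ v) →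
    cutSum f A B ≡ cutSum f A B₁ + cutSum f A B₂
  cutSum-split {n} f A B B₁ B₂ χB≡ = begin
    cutSum f A B                        ≡⟨ sumFin-cong row-split ⟩
    sumFin (λ u → row B₁ u + row B₂ u)  ≡⟨ sumFin-+ (row B₁) (row B₂) ⟩
    cutSum f A B₁ + cutSum f A B₂       ∎
    where
    open ≡-Reasoning
    row : Subset n → Fin n → ℚ
    row C u = sumFin λ v → χ A u * χ C v * f u v
    distrib : ∀ a b c x → a * (b + c) * x ≡ a * b * x + a * c * x
    distrib = solve-∀ ring
    row-split : ∀ u → row B u ≡ row B₁ u + row B₂ u
    row-split u = trans
      (sumFin-cong λ v → trans (cong (λ z → χ A u * z * f u v) (χB≡ v))
                               (distrib (χ A u) (χ B₁ v) (χ B₂ v) (f u v)))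
      (sumFin-+ (λ v → χ A u * χ B₁ v * f u v) (λ v → χ A u * χ B₂ v * f u v))

  χ-∁-split : ∀ {n} {S U : Subset n} → S ⊆ U → ∀ v → χ (∁ S) v ≡ χ (U ∩ ∁ S) v + χ (∁ U) v
  χ-∁-split {S = S} {U} S⊆U v
    rewrite lookup-map v not S | lookup-zipWith _∧_ v U (∁ S) | lookup-map v not S | lookup-map v not U
    with lookup U v in U[v] | lookup S v in S[v]
  ... | true  | true  = refl
  ... | true  | false = refl
  ... | false | false = refl
  ... | false | true with () ← trans (sym U[v]) ([]=⇒lookup (S⊆U (lookup⇒[]= v S S[v])))

  cutSum-⁅⁆ : ∀ {n} (f : Fin n → Fin n → ℚ) u → f u u ≡ 0ℚ →
    cutSum f ⁅ u ⁆ (∁ ⁅ u ⁆) ≡ sumFin (f u)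
  cutSum-⁅⁆ {n} f u fuu≡0 = begin
    cutSum f ⁅ u ⁆ (∁ ⁅ u ⁆)                         ≡⟨ sumFin-cong pull-out ⟩
    sumFin (λ x → χ ⁅ u ⁆ x * row x)                 ≡⟨ sumFin-⁅⁆ u row ⟩
    sumFin (λ v → χ (∁ ⁅ u ⁆) v * f u v)             ≡⟨ sumFin-∁⁅⁆ u (f u) fuu≡0 ⟩
    sumFin (f u)                                     ∎
    where
    open ≡-Reasoning
    row : Fin n → ℚ
    row x = sumFin (λ v → χ (∁ ⁅ u ⁆) v * f x v)
    pull-out : ∀ x → sumFin (λ v → χ ⁅ u ⁆ x * χ (∁ ⁅ u ⁆) v * f x v) ≡ χ ⁅ u ⁆ x * row x
    pull-out x = trans (sumFin-cong (λ v → *-assoc (χ ⁅ u ⁆ x) (χ (∁ ⁅ u ⁆) v) (f x v)))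
                       (sumFin-*ˡ (χ ⁅ u ⁆ x) (λ v → χ (∁ ⁅ u ⁆) v * f x v))

  deg : ∀ {n} → Graph n → Fin n → ℚ
  deg G u = sumFin λ v → [ adj G u v ]

  wdeg : ∀ {n} {G : Graph n} → WeightedSubgraph G → Fin n → ℚ
  wdeg H u = sumFin (w H u)

  w-diag : ∀ {n} {G : Graph n} (H : WeightedSubgraph G) u → w H u u ≡ 0ℚ
  w-diag {G = G} H u with w H u u ≟ 0ℚ
  ... | yes wuu≡0 = wuu≡0
  ... | no  wuu≢0 with () ← trans (sym (w-sub H u u wuu≢0)) (irref G u)

  degree-bounds : ∀ {n} {G : Graph n} {H : WeightedSubgraph G} {δ U} → Approx δ H U → ∀ u →
    (1ℚ - δ) * deg G u ≤ wdeg H u × wdeg H u ≤ (1ℚ + δ) * deg G u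
  degree-bounds {G = G} {H} (_ , cut-bounds) u
    rewrite sym (cutSum-⁅⁆ (λ x y → [ adj G x y ]) u (cong [_] (irref G u)))
          | sym (cutSum-⁅⁆ (w H) u (w-diag H u))
    = cut-bounds ⁅ u ⁆

  volume-bounds : ∀ {n} {G : Graph n} {H : WeightedSubgraph G} {δ U} → Approx δ H U → ∀ S →
    (1ℚ - δ) * vol G S ≤ volH H S × volH H S ≤ (1ℚ + δ) * vol G S
  volume-bounds {G = G} {H} {δ} {U} approx S =
      subst (_≤ volH H S) (sumFin-weighted-*ˡ (χ S) (1ℚ - δ) (deg G))
        (sumFin-weighted-mono {f = λ u → (1ℚ - δ) * deg G u} {wdeg H} (χ-nonNeg S)
          (proj₁ ∘ degrees))
    , subst (volH H S ≤_) (sumFin-weighted-*ˡ (χ S) (1ℚ + δ) (deg G))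
        (sumFin-weighted-mono {f = wdeg H} {λ u → (1ℚ + δ) * deg G u} (χ-nonNeg S)
          (proj₂ ∘ degrees))
    where
    degrees : ∀ u → (1ℚ - δ) * deg G u ≤ wdeg H u × wdeg H u ≤ (1ℚ + δ) * deg G u
    degrees = degree-bounds {G = G} {H} {δ} {U} approx

  vol-nonNeg : ∀ {n} (G : Graph n) S → 0ℚ ≤ vol G S
  vol-nonNeg G S = sumFin-nonNeg λ u →
    *-nonNeg (χ-nonNeg S u) (sumFin-nonNeg λ v → [b]-nonNeg (adj G u v))

  E-nonNeg : ∀ {n} (G : Graph n) A B → 0ℚ ≤ E G A B
  E-nonNeg G A B = sumFin-nonNeg λ u → sumFin-nonNeg λ v →
    *-nonNeg (*-nonNeg (χ-nonNeg A u) (χ-nonNeg B v)) ([b]-nonNeg (adj G u v))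

module RegularizedVolume where
  open import Defs hiding (sym)
  open import Data.Integer using (+_)
  open import Data.Product using (_×_; _,_; proj₁; proj₂)
  open import Data.Fin using (Fin)
  open import Data.Fin.Subset using (Subset; ∁; _∩_; _⊆_)
  open import Data.Rational
    using (ℚ; 0ℚ; 1ℚ; _+_; _*_; _-_; _÷_; _/_; 1/_; _≤_; _<_; NonZero; positive; nonNegative)
  open import Data.Rational.Properties
  open import Relation.Binary.PropositionalEquality
    using (_≡_; cong₂; subst; subst₂; sym; module ≡-Reasoning)
  open import Tactic.RingSolver using (solve-∀)
  open RationalBounds
  open Cuts

  [b-φ]÷φ*[φ÷b]≡1-φ÷b : ∀ b φ .{{_ : NonZero b}} .{{_ : NonZero φ}} →
    ((b - φ) ÷ φ) * (φ ÷ b) ≡ 1ℚ - φ ÷ b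
  [b-φ]÷φ*[φ÷b]≡1-φ÷b b φ = begin
    (b - φ) * 1/ φ * (φ * 1/ b)         ≡⟨ regroup b φ (1/ b) (1/ φ) ⟩
    (b * 1/ b - φ * 1/ b) * (φ * 1/ φ)  ≡⟨ cong₂ (λ u v → (u - φ * 1/ b) * v)
                                                   (*-inverseʳ b) (*-inverseʳ φ) ⟩
    (1ℚ - φ * 1/ b) * 1ℚ                ≡⟨ *-identityʳ (1ℚ - φ * 1/ b) ⟩
    1ℚ - φ ÷ b                          ∎
    where
    open ≡-Reasoning
    regroup : ∀ b φ b⁻¹ φ⁻¹ → (b - φ) * φ⁻¹ * (φ * b⁻¹) ≡ (b * b⁻¹ - φ * b⁻¹) * (φ * φ⁻¹)
    regroup = solve-∀ ring

  ÷-nonNeg : ∀ {p q} .{{_ : NonZero q}} → 0ℚ ≤ p → 0ℚ < q → 0ℚ ≤ p ÷ q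
  ÷-nonNeg {p} {q} 0≤p 0<q = *-nonNeg 0≤p (<⇒≤ (positive⁻¹ _ {{1/pos⇒pos q {{positive 0<q}}}}))

  [b-φ]÷φ*[φ÷b]≤1 : ∀ {b φ} .{{_ : NonZero b}} .{{_ : NonZero φ}} → 0ℚ < b → 0ℚ < φ →
    ((b - φ) ÷ φ) * (φ ÷ b) ≤ 1ℚ
  [b-φ]÷φ*[φ÷b]≤1 {b} {φ} 0<b 0<φ = subst (_≤ 1ℚ) (sym ([b-φ]÷φ*[φ÷b]≡1-φ÷b b φ))
    (+-monoʳ-≤ 1ℚ (neg-antimono-≤ (÷-nonNeg (<⇒≤ 0<φ) 0<b)))

  κ*a≤C : ∀ {κ a C t r} → 0ℚ ≤ κ → 0ℚ ≤ C → a ≤ t * C → t ≤ r → κ * r ≤ 1ℚ → κ * a ≤ C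
  κ*a≤C {κ} {a} {C} {t} {r} 0≤κ 0≤C a≤tC t≤r κr≤1 = begin
    κ * a        ≤⟨ *-monoˡ-≤-nonNeg κ {{nonNegative 0≤κ}} (≤-trans a≤tC
                      (*-monoʳ-≤-nonNeg C {{nonNegative 0≤C}} t≤r)) ⟩
    κ * (r * C)  ≡⟨ *-assoc κ r C ⟨
    κ * r * C    ≤⟨ *-monoʳ-≤-nonNeg C {{nonNegative 0≤C}} κr≤1 ⟩
    1ℚ * C       ≡⟨ *-identityˡ C ⟩
    C            ∎
    where open ≤-Reasoning

  four : ℚ
  four = + 4 / 1

  vol°-within : ∀ {δ κ V Vₕ a e aₕ eₕ} → 0ℚ ≤ δ → 0ℚ ≤ κ →
    Within (δ * V) Vₕ V → Within (δ * (a + e)) aₕ a → Within (δ * (a + e)) (aₕ + eₕ) (a + e) →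
    κ * a ≤ V + κ * e → Within (four * δ * (V + κ * e)) (Vₕ + κ * eₕ) (V + κ * e)
  vol°-within {δ} {κ} {V} {Vₕ} {a} {e} {aₕ} {eₕ} 0≤δ 0≤κ V≈ a≈ ae≈ κa≤vol° =
    ≤-trans (within-+ {x = Vₕ} {κ * eₕ} {V} {κ * e} V≈ (within-*ˡ 0≤κ e≈)) slack
    where
    cancel : ∀ x y → (x + y) - x ≡ y
    cancel = solve-∀ ring
    e≈ : Within (δ * (a + e) + δ * (a + e)) eₕ e
    e≈ = subst₂ (Within (δ * (a + e) + δ * (a + e))) (cancel aₕ eₕ) (cancel a e)
           (within-- {x = aₕ + eₕ} {aₕ} {a + e} {a} ae≈ a≈)
    -- Written with 1ℚ + 1ℚ + 1ℚ + 1ℚ: the solver would treat four as an opaque atom.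
    certificate : ∀ δ κ V a e →
      (1ℚ + 1ℚ + 1ℚ + 1ℚ) * δ * (V + κ * e) - (δ * V + κ * (δ * (a + e) + δ * (a + e)))
        ≡ δ * V + (δ + δ) * ((V + κ * e) - κ * a)
    certificate = solve-∀ ring
    slack : δ * V + κ * (δ * (a + e) + δ * (a + e)) ≤ four * δ * (V + κ * e)
    slack = 0≤q-p⇒p≤q (subst (0ℚ ≤_) (sym (certificate δ κ V a e))
      (+-nonNeg (≤-trans (0≤∣p∣ (Vₕ - V)) V≈) (*-nonNeg (+-nonNeg 0≤δ 0≤δ) (p≤q⇒0≤q-p κa≤vol°))))

  vol°-nonNeg : ∀ {n} (G : Graph n) {κ} U S → 0ℚ ≤ κ → 0ℚ ≤ volC κ G U S
  vol°-nonNeg G U S 0≤κ = +-nonNeg (vol-nonNeg G S) (*-nonNeg 0≤κ (E-nonNeg G S (∁ U)))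

  conductance⇒κ*a≤vol° : ∀ {n} {G : Graph n} {U S : Subset n} {κ φ̂ r} →
    0ℚ ≤ κ → 0ℚ < φ̂ → φ̂ ≤ r → κ * r ≤ 1ℚ →
    ConductanceBelow κ G U S φ̂ → κ * E G S (U ∩ ∁ S) ≤ volC κ G U S
  conductance⇒κ*a≤vol° {G = G} {U} {S} {κ} {φ̂} 0≤κ 0<φ̂ φ̂≤r κr≤1 conductance =
    κ*a≤C 0≤κ (vol°-nonNeg G U S 0≤κ) a≤φ̂vol° φ̂≤r κr≤1
    where
    a≤φ̂vol° : E G S (U ∩ ∁ S) ≤ φ̂ * volC κ G U S
    a≤φ̂vol° = ≤-trans (<⇒≤ conductance)
      (*-monoˡ-≤-nonNeg φ̂ {{nonNegative (<⇒≤ 0<φ̂)}} (p⊓q≤p (volC κ G U S) (volC κ G U (U ∩ ∁ S))))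

  approx⇒vol°-within : ∀ {n} {G : Graph n} {H : WeightedSubgraph G} {δ κ} {U S : Subset n} →
    0ℚ ≤ δ → 0ℚ ≤ κ → Approx δ H U → S ⊆ U → κ * E G S (U ∩ ∁ S) ≤ volC κ G U S →
    Within (four * δ * volC κ G U S) (volCH κ H U S) (volC κ G U S)
  approx⇒vol°-within {n} {G} {H} {δ} {κ} {U} {S} 0≤δ 0≤κ approx@(cut-in-U , cut-in-V) S⊆U κa≤vol° =
    vol°-within {δ} {κ} {vol G S} {volH H S} {a} {e} {aₕ} {eₕ} 0≤δ 0≤κ V≈ a≈ ae≈ κa≤vol°
    where
    adjacency : Fin n → Fin n → ℚ
    adjacency x y = [ adj G x y ]
    a e aₕ eₕ : ℚ
    a  = E G S (U ∩ ∁ S)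
    e  = E G S (∁ U)
    aₕ = wt H S (U ∩ ∁ S)
    eₕ = wt H S (∁ U)
    split-∁S : ∀ (f : Fin n → Fin n → ℚ) →
      cutSum f S (∁ S) ≡ cutSum f S (U ∩ ∁ S) + cutSum f S (∁ U)
    split-∁S f = cutSum-split f S (∁ S) (U ∩ ∁ S) (∁ U) (χ-∁-split S⊆U)
    V≈ : Within (δ * vol G S) (volH H S) (vol G S)
    V≈ = within-relative {δ} {vol G S} (proj₁ vol-bounds) (proj₂ vol-bounds)
      where
      vol-bounds : (1ℚ - δ) * vol G S ≤ volH H S × volH H S ≤ (1ℚ + δ) * vol G S
      vol-bounds = volume-bounds {G = G} {H} {δ} {U} approx S
    a≈ : Within (δ * (a + e)) aₕ a
    a≈ = subst (λ z → Within (δ * z) aₕ a) (split-∁S adjacency) (cut-in-U S S⊆U)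
    ae≈ : Within (δ * (a + e)) (aₕ + eₕ) (a + e)
    ae≈ = subst₂ (λ z z′ → Within (δ * z) z′ z) (split-∁S adjacency) (split-∁S (w H))
            (within-relative {δ} {E G S (∁ S)} (proj₁ (cut-in-V S)) (proj₂ (cut-in-V S)))

open import Defs
open import Data.Nat using (ℕ; _≤_)
open import Data.Integer using (+_)
open import Data.Product using (_×_)
open import Data.Fin.Subset using (Subset; _⊂_; Nonempty)
open import Data.Rational using (ℚ; 0ℚ; 1ℚ; _<_; _/_; _*_; _-_; _÷_; NonZero)
open import Data.Rational as Q using ()

import Data.Nat as ℕ
import Data.Nat.Properties as ℕP
import Data.Integer as ℤ
import Data.Rational.Properties as QP
open import Data.Fin.Subset using (∁; _∩_)
open import Data.Product using (_,_; proj₁; proj₂)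
open RationalBounds
open LogComparison
open RegularizedVolume

lemma5p6 : (n : ℕ) → 2 ≤ n →
    (b φ φ̂ c δ : ℚ) → .{{_ : NonZero b}} → .{{_ : NonZero φ}} →
    0ℚ < b → b < 1ℚ → 0ℚ < φ → φ < 1ℚ → 0ℚ < φ̂ → φ̂ < 1ℚ →
    0ℚ < c → c < 1ℚ → 0ℚ < δ → δ < 1ℚ →
    c Q.≤ (+ 1 / 5) → φ < b →
    MulLog≤ n δ (c * c) →
    φ̂ Q.≤ (φ ÷ b) →
    (G : Graph n) (U : Subset n) (H : WeightedSubgraph G) →
    Approx δ H U →
    (S : Subset n) → Nonempty S → S ⊂ U →
    ConductanceBelow ((b - φ) ÷ φ) G U S φ̂ →
    MulLog≤ n (volC ((b - φ) ÷ φ) G U S - volCH ((b - φ) ÷ φ) H U S)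
              (c * volC ((b - φ) ÷ φ) G U S)
    × MulLog≤ n (volCH ((b - φ) ÷ φ) H U S - volC ((b - φ) ÷ φ) G U S)
              (c * volC ((b - φ) ÷ φ) G U S)
lemma5p6 n 2≤n b φ φ̂ c δ 0<b _ 0<φ _ 0<φ̂ _ 0<c _ 0<δ _ c≤1/5 φ<b δlog≤c² φ̂≤φ/b
         G U H approx S _ (S⊆U , _) conductance =
    mulLog≤-transfer n 0≤4 0<δ 0<c 4c≤1 0≤vol° δlog≤c² (proj₂ vol°-gaps)
  , mulLog≤-transfer n 0≤4 0<δ 0<c 4c≤1 0≤vol° δlog≤c² (proj₁ vol°-gaps)
  where
  instance
    n≢0 : ℕ.NonZero n
    n≢0 = ℕ.>-nonZero (ℕP.<-≤-trans ℕ.z<s 2≤n)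
  κ : ℚ
  κ = (b - φ) ÷ φ
  0≤κ : 0ℚ Q.≤ κ
  0≤κ = ÷-nonNeg (p≤q⇒0≤q-p (QP.<⇒≤ φ<b)) 0<φ
  0≤vol° : 0ℚ Q.≤ volC κ G U S
  0≤vol° = vol°-nonNeg G U S 0≤κ
  0≤4 : 0ℚ Q.≤ four
  0≤4 = QP.nonNegative⁻¹ four
  4c≤1 : four * c Q.≤ 1ℚ
  4c≤1 = QP.≤-trans (QP.*-monoˡ-≤-nonNeg four c≤1/5) (Q.*≤* (ℤ.+≤+ (ℕP.n≤1+n 4)))
  κa≤vol° : κ * E G S (U ∩ ∁ S) Q.≤ volC κ G U S
  κa≤vol° = conductance⇒κ*a≤vol° {G = G} {U} {S} 0≤κ 0<φ̂ φ̂≤φ/b ([b-φ]÷φ*[φ÷b]≤1 0<b 0<φ) conductance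
  vol°≈ : Within (four * δ * volC κ G U S) (volCH κ H U S) (volC κ G U S)
  vol°≈ = approx⇒vol°-within {G = G} {H} {δ} {κ} {U} {S} (QP.<⇒≤ 0<δ) 0≤κ approx S⊆U κa≤vol°
  vol°-gaps : volCH κ H U S - volC κ G U S Q.≤ four * δ * volC κ G U S
            × volC κ G U S - volCH κ H U S Q.≤ four * δ * volC κ G U S
  vol°-gaps = within⇒≤ {x = volCH κ H U S} vol°≈
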